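{- Consider the algorithm $\mathcal{A}_L$ described in the context, run on a uniformly random permutation of $n$ items with distinct profits. For any two items $i$ and $j$, let $p_{ij}$ be the probability that $i$ is selected as the first item and $j$ as the second item. Then $p_{ij}=p_{ji}$.
   Context: Knapsack setting: items $[n]$ with sizes $s_i$ and distinct profits $v_i$, capacity $W$, all items satisfying $W/3<s_i\le W$; items arrive in uniformly random order, one per round. Algorithm $\mathcal{A}_L$ with parameters $0<c<d<1$ ($cn,dn\in\mathbb{N}$): in rounds $1,\dots,cn$ it discards all items; $v^*$ is the maximum profit among items of rounds $1,\dots,cn$. In rounds $cn+1,\dots,dn$ it selects the first two items whose profit exceeds $v^*$ (first and second selected item in arrival order) and packs them if feasible. After round $dn$ it discards all items.
   Formalization: The profits $v_i$, the sizes $s_i$ and the capacity $W$ are rational numbers. -}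

module Defs where

open import Data.Bool using (Bool; true; false; _∧_; not)
open import Data.Nat using (ℕ; zero; suc; _∸_; _!)
open import Data.Nat.Properties using (_!≢0)
open import Data.Fin using (Fin)
open import Data.Fin.Properties using () renaming (_≟_ to _≟ᶠ_)
open import Data.List using (List; []; _∷_; [_]; map; concatMap; allFin; take; drop; filterᵇ; length)
open import Data.Integer using (+_)
open import Data.Rational using (ℚ; _/_)
open import Data.Rational.Properties using (_<?_)
open import Relation.Nullary using (does)

allᵇ : ∀ {A : Set} → (A → Bool) → List A → Bool
allᵇ p []       = true
allᵇ p (x ∷ xs) = p x ∧ allᵇ p xs

words : (n k : ℕ) → List (List (Fin n))
words n zero    = [ [] ]
words n (suc k) = concatMap (λ w → map (_∷ w) (allFin n)) (words n k)

distinct : ∀ {n} → List (Fin n) → Bool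
distinct []       = true
distinct (x ∷ xs) = allᵇ (λ y → not (does (x ≟ᶠ y))) xs ∧ distinct xs

-- The arrival orders: all permutations of the n items (duplicate-free words of length n).
-- Position r (0-based) in the list is the item arriving in round r+1.
arrivalOrders : (n : ℕ) → List (List (Fin n))
arrivalOrders n = filterᵇ distinct (words n n)

-- Algorithm A_L with sample length a = cn and end of selection phase b = dn, profits v.
-- An item x "exceeds v*" iff its profit exceeds every profit of rounds 1..a
-- (i.e. exceeds their maximum v*, the set being nonempty since a ≥ 1).
exceedsSample : ∀ {n} → (Fin n → ℚ) → ℕ → List (Fin n) → Fin n → Bool
exceedsSample v a σ x = allᵇ (λ y → does (v y <? v x)) (take a σ)

candidates : ∀ {n} → (Fin n → ℚ) → ℕ → ℕ → List (Fin n) → List (Fin n)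
candidates v a b σ = filterᵇ (exceedsSample v a σ) (take (b ∸ a) (drop a σ))

selectsFirstSecond : ∀ {n} → (Fin n → ℚ) → ℕ → ℕ → List (Fin n) → Fin n → Fin n → Bool
selectsFirstSecond v a b σ i j with candidates v a b σ
... | x ∷ y ∷ _ = does (x ≟ᶠ i) ∧ does (y ≟ᶠ j)
... | _         = false

pSel : (n : ℕ) → (Fin n → ℚ) → ℕ → ℕ → Fin n → Fin n → ℚ
pSel n v a b i j =
  (+ length (filterᵇ (λ σ → selectsFirstSecond v a b σ i j) (arrivalOrders n))) / (n !)
  where instance _ = n !≢0

{-# OPTIONS --safe #-}
module Submission where

-- The items that can be selected beat every profit of the sample, so they never occur in it.
-- Hence if i and j are the first two selected items of an arrival order σ, relabelling σ by
-- the transposition (i j) leaves the sample and the test "exceeds v*" untouched and merely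
-- exchanges i and j among the selected items.  Relabelling by a permutation of the items
-- permutes the set of arrival orders, so both events have the same number of favourable orders.

open import Defs
open import Data.Nat using (ℕ; _<_; zero; suc; _∸_; _!)
open import Data.Nat.Properties using (_!≢0)
open import Data.Fin using (Fin)
open import Data.Integer using (+_)
open import Data.Rational using (ℚ; _/_; _*_) renaming (_<_ to _<ℚ_; _≤_ to _≤ℚ_)
open import Function.Definitions using (Injective)
open import Relation.Binary.PropositionalEquality
  using (_≡_; _≢_; _≗_; refl; sym; trans; cong; cong₂; subst; module ≡-Reasoning)
open import Function.Base using (_∘_)
open import Function.Bundles using (mk⇔; Injection; Equivalence)
open import Function.Properties.Inverse using (↔⇒↣)
open import Data.Bool using (Bool; true; false; _∧_; not; T)
open import Data.Bool.Properties using (T-≡; T-∧)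
open import Data.Unit using (tt)
open import Data.Product using (∃; _×_; _,_; proj₂)
open import Data.List using (List; []; _∷_; map; filterᵇ; take; drop; length; allFin)
open import Data.List.Properties
  using (∷-injectiveˡ; ∷-injectiveʳ; take-map; drop-map; length-map; map-∘; map-id-local; map-injective; filter-≐)
open import Data.List.Membership.Propositional using (_∈_)
open import Data.List.Membership.Propositional.Properties
  using (∈-map⁺; ∈-map⁻; ∈-concat⁺′; ∈-concat⁻′; ∈-filter⁺; ∈-filter⁻; ∈-allFin)
open import Data.List.Membership.Propositional.Properties.WithK using (unique∧set⇒bag)
open import Data.List.Relation.Unary.Any using (here; there)
open import Data.List.Relation.Unary.All as All using (All; []; _∷_)
import Data.List.Relation.Unary.All.Properties as All
import Data.List.Relation.Unary.AllPairs as AllPairs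
import Data.List.Relation.Unary.AllPairs.Properties as AllPairs
open import Data.List.Relation.Unary.Unique.Propositional using (Unique)
import Data.List.Relation.Unary.Unique.Propositional.Properties as Unique
open import Data.List.Relation.Binary.Permutation.Propositional using (_↭_)
open import Data.List.Relation.Binary.Permutation.Propositional.Properties using (↭-length; filter-↭)
open import Data.List.Relation.Binary.BagAndSetEquality using (∼bag⇒↭)
open import Data.Fin.Properties using () renaming (_≟_ to _≟ᶠ_)
open import Data.Fin.Permutation using (Permutation′; _⟨$⟩ʳ_; _⟨$⟩ˡ_; inverseˡ; inverseʳ; flip; transpose)
open import Data.Rational.Properties using (_<?_; <-irrefl)
open import Relation.Nullary using (Dec; does; yes; no; ¬_)
open import Relation.Nullary.Decidable using (T?; toWitness; isYes≗does; dec-true; dec-false)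

private
  variable
    A B : Set
    n : ℕ

filterᵇ-map : (p : B → Bool) (f : A → B) (xs : List A) →
              filterᵇ p (map f xs) ≡ map f (filterᵇ (p ∘ f) xs)
filterᵇ-map p f []       = refl
filterᵇ-map p f (x ∷ xs) with p (f x)
... | true  = cong (f x ∷_) (filterᵇ-map p f xs)
... | false = filterᵇ-map p f xs

filterᵇ-≐ : {p q : A → Bool} → (∀ {x} → T (p x) → T (q x)) → (∀ {x} → T (q x) → T (p x)) →
            filterᵇ p ≗ filterᵇ q
filterᵇ-≐ {p = p} {q} p⇒q q⇒p = filter-≐ (T? ∘ p) (T? ∘ q) (p⇒q , q⇒p)

filterᵇ-cong : {p q : A → Bool} → p ≗ q → filterᵇ p ≗ filterᵇ q
filterᵇ-cong p≗q = filterᵇ-≐ (λ {x} → subst T (p≗q x)) (λ {x} → subst T (sym (p≗q x)))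

allᵇ⇒All : (p : A → Bool) (xs : List A) → T (allᵇ p xs) → All (T ∘ p) xs
allᵇ⇒All p []       _ = []
allᵇ⇒All p (x ∷ xs) t with px , pxs ← Equivalence.to T-∧ t = px ∷ allᵇ⇒All p xs pxs

map-inverseˡ : (π : Permutation′ n) (σ : List (Fin n)) → map (π ⟨$⟩ˡ_) (map (π ⟨$⟩ʳ_) σ) ≡ σ
map-inverseˡ π σ = trans (sym (map-∘ σ)) (map-id-local (All.tabulate λ _ → inverseˡ π))

map-inverseʳ : (π : Permutation′ n) (σ : List (Fin n)) → map (π ⟨$⟩ʳ_) (map (π ⟨$⟩ˡ_) σ) ≡ σ
map-inverseʳ π σ = trans (sym (map-∘ σ)) (map-id-local (All.tabulate λ _ → inverseʳ π))

transpose-at-i : (i j : Fin n) → transpose i j ⟨$⟩ʳ i ≡ j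
transpose-at-i i j rewrite dec-true (i ≟ᶠ i) refl = refl

transpose-at-j : (i j : Fin n) → transpose i j ⟨$⟩ʳ j ≡ i
transpose-at-j i j with j ≟ᶠ i
... | yes j≡i = j≡i
... | no  _   rewrite dec-true (j ≟ᶠ j) refl = refl

transpose-elsewhere : (i j : Fin n) {k : Fin n} → k ≢ i → k ≢ j → transpose i j ⟨$⟩ʳ k ≡ k
transpose-elsewhere i j k≢i k≢j rewrite dec-false (_ ≟ᶠ i) k≢i | dec-false (_ ≟ᶠ j) k≢j = refl

∘-transpose-≗ : {i j : Fin n} (f : Fin n → A) → f i ≡ f j → f ∘ (transpose i j ⟨$⟩ʳ_) ≗ f
∘-transpose-≗ {i = i} {j} f fi≡fj k = by-cases (k ≟ᶠ i) (k ≟ᶠ j)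
  where
  by-cases : Dec (k ≡ i) → Dec (k ≡ j) → f (transpose i j ⟨$⟩ʳ k) ≡ f k
  by-cases (yes refl) _          = trans (cong f (transpose-at-i k j)) (sym fi≡fj)
  by-cases (no _)     (yes refl) = trans (cong f (transpose-at-j i k)) fi≡fj
  by-cases (no k≢i)   (no k≢j)   = cong f (transpose-elsewhere i j k≢i k≢j)

∈-words⁺ : ∀ k (σ : List (Fin n)) → length σ ≡ k → σ ∈ words n k
∈-words⁺ zero    []      refl = here refl
∈-words⁺ (suc k) (x ∷ σ) refl =
  ∈-concat⁺′ (∈-map⁺ (_∷ σ) (∈-allFin x)) (∈-map⁺ _ (∈-words⁺ k σ refl))

∈-words⁻ : ∀ k {σ : List (Fin n)} → σ ∈ words n k → length σ ≡ k
∈-words⁻ zero    (here refl) = refl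
∈-words⁻ {n} (suc k) σ∈ with ∈-concat⁻′ (map (λ w → map (_∷ w) (allFin n)) (words n k)) σ∈
... | _ , σ∈block , block∈ with ∈-map⁻ _ block∈
...   | w , w∈ , refl with ∈-map⁻ (_∷ w) σ∈block
...     | _ , _ , refl = cong suc (∈-words⁻ k w∈)

words-unique : ∀ n k → Unique (words n k)
words-unique n zero    = [] AllPairs.∷ AllPairs.[]
words-unique n (suc k) =
  Unique.concat⁺ (All.map⁺ (All.universal block-unique (words n k)))
                 (AllPairs.map⁺ (AllPairs.map blocks-disjoint (words-unique n k)))
  where
  block : List (Fin n) → List (List (Fin n))
  block w = map (_∷ w) (allFin n)
  block-unique : ∀ w → Unique (block w)
  block-unique w = Unique.map⁺ ∷-injectiveˡ (Unique.allFin⁺ n)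
  blocks-disjoint : ∀ {w w′} → w ≢ w′ → ∀ {σ} → ¬ (σ ∈ block w × σ ∈ block w′)
  blocks-disjoint w≢w′ (σ∈ , σ∈′) with ∈-map⁻ _ σ∈ | ∈-map⁻ _ σ∈′
  ... | _ , _ , refl | _ , _ , eq = w≢w′ (∷-injectiveʳ eq)

does-≟-injective : {f : Fin n → Fin n} → Injective _≡_ _≡_ f →
                   ∀ x y → does (f x ≟ᶠ f y) ≡ does (x ≟ᶠ y)
does-≟-injective {f = f} f-inj x y with x ≟ᶠ y
... | yes refl = dec-true (f x ≟ᶠ f x) refl
... | no  x≢y  = dec-false (f x ≟ᶠ f y) (x≢y ∘ f-inj)

distinct-map : {f : Fin n → Fin n} → Injective _≡_ _≡_ f → ∀ σ → distinct (map f σ) ≡ distinct σ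
distinct-map             f-inj []      = refl
distinct-map {f = f} f-inj (x ∷ σ) = cong₂ _∧_ (fresh σ) (distinct-map f-inj σ)
  where
  fresh : ∀ ys → allᵇ (λ y → not (does (f x ≟ᶠ y))) (map f ys)
               ≡ allᵇ (λ y → not (does (x ≟ᶠ y))) ys
  fresh []       = refl
  fresh (y ∷ ys) = cong₂ _∧_ (cong not (does-≟-injective f-inj x y)) (fresh ys)

map-∈-arrivalOrders : {f : Fin n → Fin n} → Injective _≡_ _≡_ f →
                      ∀ {σ} → σ ∈ arrivalOrders n → map f σ ∈ arrivalOrders n
map-∈-arrivalOrders {n} {f} f-inj {σ} σ∈ with σ∈words , σ-distinct ← ∈-filter⁻ (T? ∘ distinct) σ∈ =
  ∈-filter⁺ (T? ∘ distinct)
    (∈-words⁺ n (map f σ) (trans (length-map f σ) (∈-words⁻ n σ∈words)))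
    (subst T (sym (distinct-map f-inj σ)) σ-distinct)

arrivalOrders-unique : ∀ n → Unique (arrivalOrders n)
arrivalOrders-unique n = Unique.filter⁺ (T? ∘ distinct) (words-unique n n)

map-arrivalOrders-↭ : (π : Permutation′ n) → map (map (π ⟨$⟩ʳ_)) (arrivalOrders n) ↭ arrivalOrders n
map-arrivalOrders-↭ {n} π = ∼bag⇒↭ (unique∧set⇒bag
  (Unique.map⁺ (map-injective π-inj) (arrivalOrders-unique n))
  (arrivalOrders-unique n)
  (mk⇔ to from))
  where
  π-inj : Injective _≡_ _≡_ (π ⟨$⟩ʳ_)
  π-inj = Injection.injective (↔⇒↣ π)
  π⁻¹-inj : Injective _≡_ _≡_ (π ⟨$⟩ˡ_)
  π⁻¹-inj = Injection.injective (↔⇒↣ (flip π))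
  to : ∀ {σ} → σ ∈ map (map (π ⟨$⟩ʳ_)) (arrivalOrders n) → σ ∈ arrivalOrders n
  to σ∈ with τ , τ∈ , refl ← ∈-map⁻ _ σ∈ = map-∈-arrivalOrders π-inj τ∈
  from : ∀ {σ} → σ ∈ arrivalOrders n → σ ∈ map (map (π ⟨$⟩ʳ_)) (arrivalOrders n)
  from {σ} σ∈ = subst (_∈ map (map (π ⟨$⟩ʳ_)) (arrivalOrders n)) (map-inverseʳ π σ)
    (∈-map⁺ _ (map-∈-arrivalOrders π⁻¹-inj σ∈))

length-filterᵇ-arrivalOrders-relabel :
  (π : Permutation′ n) (P : List (Fin n) → Bool) →
  length (filterᵇ (P ∘ map (π ⟨$⟩ʳ_)) (arrivalOrders n)) ≡ length (filterᵇ P (arrivalOrders n))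
length-filterᵇ-arrivalOrders-relabel {n} π P = begin
  length (filterᵇ (P ∘ relabel) orders)              ≡⟨ length-map relabel (filterᵇ (P ∘ relabel) orders) ⟨
  length (map relabel (filterᵇ (P ∘ relabel) orders)) ≡⟨ cong length (filterᵇ-map P relabel orders) ⟨
  length (filterᵇ P (map relabel orders))             ≡⟨ ↭-length (filter-↭ (T? ∘ P) (map-arrivalOrders-↭ π)) ⟩
  length (filterᵇ P orders)                           ∎
  where
  open ≡-Reasoning
  relabel : List (Fin n) → List (Fin n)
  relabel = map (π ⟨$⟩ʳ_)
  orders : List (List (Fin n))
  orders = arrivalOrders n

module _ (v : Fin n → ℚ) (a b : ℕ) where

  sample-¬exceedsSample : ∀ σ {x} → x ∈ take a σ → ¬ T (exceedsSample v a σ x)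
  sample-¬exceedsSample σ {x} x∈ x-exceeds =
    <-irrefl refl (toWitness (subst T (sym (isYes≗does (v x <? v x))) x<x))
    where
    x<x : T (does (v x <? v x))
    x<x = All.lookup (allᵇ⇒All (λ y → does (v y <? v x)) (take a σ) x-exceeds) x∈

  candidates-map : ∀ σ {f : Fin n → Fin n} →
                   All (λ x → f x ≡ x) (take a σ) →
                   (∀ x → exceedsSample v a σ (f x) ≡ exceedsSample v a σ x) →
                   candidates v a b (map f σ) ≡ map f (candidates v a b σ)
  candidates-map σ {f} f-fixes-sample f-preserves = begin
    filterᵇ (exceedsSample v a (map f σ)) (take (b ∸ a) (drop a (map f σ))) ≡⟨ cong₂ filterᵇ same-test same-window ⟩
    filterᵇ exceeds (map f window)                                           ≡⟨ filterᵇ-map exceeds f window ⟩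
    map f (filterᵇ (exceeds ∘ f) window)                                     ≡⟨ cong (map f) (filterᵇ-cong f-preserves window) ⟩
    map f (filterᵇ exceeds window)                                           ∎
    where
    open ≡-Reasoning
    exceeds : Fin n → Bool
    exceeds = exceedsSample v a σ
    window : List (Fin n)
    window = take (b ∸ a) (drop a σ)
    same-test : exceedsSample v a (map f σ) ≡ exceeds
    same-test = cong (λ S x → allᵇ (λ y → does (v y <? v x)) S)
                     (trans (take-map a σ) (map-id-local f-fixes-sample))
    same-window : take (b ∸ a) (drop a (map f σ)) ≡ map f window
    same-window = trans (cong (take (b ∸ a)) (drop-map a σ)) (take-map (b ∸ a) (drop a σ))

  candidates-transpose : ∀ σ {i j r} → candidates v a b σ ≡ i ∷ j ∷ r →
    candidates v a b (map (transpose i j ⟨$⟩ʳ_) σ) ≡ j ∷ i ∷ map (transpose i j ⟨$⟩ʳ_) r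
  candidates-transpose σ {i} {j} {r} eq = begin
    candidates v a b (map τ σ) ≡⟨ candidates-map σ τ-fixes-sample τ-preserves ⟩
    map τ (candidates v a b σ) ≡⟨ cong (map τ) eq ⟩
    τ i ∷ τ j ∷ map τ r        ≡⟨ cong₂ (λ x y → x ∷ y ∷ map τ r) (transpose-at-i i j) (transpose-at-j i j) ⟩
    j ∷ i ∷ map τ r            ∎
    where
    open ≡-Reasoning
    τ : Fin n → Fin n
    τ = transpose i j ⟨$⟩ʳ_
    exceeds : Fin n → Bool
    exceeds = exceedsSample v a σ
    candidate-exceeds : ∀ {x} → x ∈ candidates v a b σ → T (exceeds x)
    candidate-exceeds x∈ = proj₂ (∈-filter⁻ (T? ∘ exceeds) {xs = take (b ∸ a) (drop a σ)} x∈)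
    i-exceeds : T (exceeds i)
    i-exceeds = candidate-exceeds (subst (i ∈_) (sym eq) (here refl))
    j-exceeds : T (exceeds j)
    j-exceeds = candidate-exceeds (subst (j ∈_) (sym eq) (there (here refl)))
    exceeds-j≡exceeds-i : exceeds j ≡ exceeds i
    exceeds-j≡exceeds-i = trans (Equivalence.to T-≡ j-exceeds) (sym (Equivalence.to T-≡ i-exceeds))
    τ-fixes-sample : All (λ x → τ x ≡ x) (take a σ)
    τ-fixes-sample = All.tabulate λ x∈ → transpose-elsewhere i j
      (λ { refl → sample-¬exceedsSample σ x∈ i-exceeds })
      (λ { refl → sample-¬exceedsSample σ x∈ j-exceeds })
    τ-preserves : exceeds ∘ τ ≗ exceeds
    τ-preserves = ∘-transpose-≗ exceeds (sym exceeds-j≡exceeds-i)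

  selectsFirstSecond⇒candidates : ∀ σ {i j} → T (selectsFirstSecond v a b σ i j) →
                                  ∃ λ r → candidates v a b σ ≡ i ∷ j ∷ r
  selectsFirstSecond⇒candidates σ {i} {j} selected with candidates v a b σ
  ... | x ∷ y ∷ r with x ≟ᶠ i | y ≟ᶠ j
  ...   | yes refl | yes refl = r , refl

  candidates⇒selectsFirstSecond : ∀ σ {i j r} → candidates v a b σ ≡ i ∷ j ∷ r →
                                  T (selectsFirstSecond v a b σ i j)
  candidates⇒selectsFirstSecond σ {i} {j} eq
    rewrite eq | dec-true (i ≟ᶠ i) refl | dec-true (j ≟ᶠ j) refl = tt

  selectsFirstSecond-transpose : ∀ σ {i j} → T (selectsFirstSecond v a b σ i j) →
    T (selectsFirstSecond v a b (map (transpose i j ⟨$⟩ʳ_) σ) j i)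
  selectsFirstSecond-transpose σ selected with r , eq ← selectsFirstSecond⇒candidates σ selected =
    candidates⇒selectsFirstSecond _ (candidates-transpose σ eq)

  selectsFirstSecond-transpose⁻ : ∀ σ {i j} →
    T (selectsFirstSecond v a b (map (transpose i j ⟨$⟩ʳ_) σ) j i) → T (selectsFirstSecond v a b σ i j)
  selectsFirstSecond-transpose⁻ σ {i} {j} selected =
    subst (λ σ′ → T (selectsFirstSecond v a b σ′ i j)) (map-inverseˡ (transpose i j) σ)
          (selectsFirstSecond-transpose (map (transpose i j ⟨$⟩ʳ_) σ) selected)

  count-selectsFirstSecond-sym : ∀ i j →
    length (filterᵇ (λ σ → selectsFirstSecond v a b σ i j) (arrivalOrders n)) ≡
    length (filterᵇ (λ σ → selectsFirstSecond v a b σ j i) (arrivalOrders n))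
  count-selectsFirstSecond-sym i j = begin
    length (filterᵇ (λ σ → selectsFirstSecond v a b σ i j) (arrivalOrders n))
      ≡⟨ cong length (filterᵇ-≐ (λ {σ} → selectsFirstSecond-transpose σ)
                                (λ {σ} → selectsFirstSecond-transpose⁻ σ) (arrivalOrders n)) ⟩
    length (filterᵇ (λ σ → selectsFirstSecond v a b (map (transpose i j ⟨$⟩ʳ_) σ) j i) (arrivalOrders n))
      ≡⟨ length-filterᵇ-arrivalOrders-relabel (transpose i j) (λ σ → selectsFirstSecond v a b σ j i) ⟩
    length (filterᵇ (λ σ → selectsFirstSecond v a b σ j i) (arrivalOrders n))
      ∎
    where open ≡-Reasoning

lemma6 : (n a b : ℕ) → 0 < a → a < b → b < n →
         (s v : Fin n → ℚ) (W : ℚ) →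
         Injective _≡_ _≡_ v →
         (∀ k → (+ 1 / 3) * W <ℚ s k) → (∀ k → s k ≤ℚ W) →
         (i j : Fin n) → pSel n v a b i j ≡ pSel n v a b j i
lemma6 n a b _ _ _ _ v _ _ _ _ i j = cong (λ k → + k / n !) (count-selectsFirstSecond-sym v a b i j)
  where instance _ = n !≢0
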